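{- Under the Modified CFLS coloring $\varphi$ of $K_n$ ($n=2^{m^2}$), there is no copy of $K_5$ which is a 2-2-2-2-2 coloring in which two color classes are matchings and three are paths.
   Context: Let $m$ be a positive integer and $n=2^{m^2}$. The vertices of $K_n$ are the binary strings $v\in\{0,1\}^{m^2}$, written as $v=(v^{(1)},\dots,v^{(m)})$ with each block $v^{(k)}\in\{0,1\}^m$. Vertices (and blocks) are linearly ordered as binary integers: $x<y$ iff at the first bit where they differ, $x$ has 0 and $y$ has 1. For $x<y$, let $i$ be the first index with $x^{(i)}\ne y^{(i)}$; for $k\in[m]$ let $i_k$ be the first position at which the bits of $x^{(k)}$ and $y^{(k)}$ differ ($i_k=0$ if $x^{(k)}=y^{(k)}$), and let $\delta_k=+1$ if $x^{(k)}\le y^{(k)}$ and $\delta_k=-1$ if $x^{(k)}>y^{(k)}$. The Modified CFLS coloring assigns to edge $xy$ the color $\varphi(xy)=((i,\{x^{(i)},y^{(i)}\}),i_1,\dots,i_m,\delta_1,\dots,\delta_m)$. A copy of $K_5$ is a 2-2-2-2-2 coloring if its ten edges receive exactly five colors, each on exactly two edges; each color class is then either a matching (two disjoint edges) or a path of length 2 (two edges sharing a vertex). -}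

module Defs where

open import Data.Bool using (Bool; true; false; if_then_else_; _∧_; _∨_; not)
open import Data.Bool.Properties using () renaming (_≟_ to _≟ᵇ_)
open import Data.Nat using (ℕ; zero; suc)
open import Data.Integer using (ℤ; 1ℤ; -1ℤ)
open import Data.Fin using (Fin) renaming (_<_ to _<ᶠ_)
import Data.Fin as Fin
open import Data.Vec using (Vec; []; _∷_; lookup; zipWith)
open import Data.Vec.Properties using () renaming (≡-dec to vec-≡-dec)
open import Data.Maybe using (Maybe; just; nothing)
open import Data.Product using (_×_; _,_; proj₁; proj₂; Σ)
open import Data.Sum using (_⊎_)
open import Relation.Nullary using (¬_; yes; no)
open import Relation.Binary.PropositionalEquality using (_≡_; _≢_)

-- Bit strings (blocks) in {0,1}^m, with false = 0, true = 1.

lexLt : ∀ {n} → Vec Bool n → Vec Bool n → Bool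
lexLt [] [] = false
lexLt (false ∷ xs) (false ∷ ys) = lexLt xs ys
lexLt (true  ∷ xs) (true  ∷ ys) = lexLt xs ys
lexLt (false ∷ xs) (true  ∷ ys) = true
lexLt (true  ∷ xs) (false ∷ ys) = false

-- First (1-based) position at which two bit strings differ; 0 if equal.
firstDiffPos : ∀ {n} → Vec Bool n → Vec Bool n → ℕ
firstDiffPos [] [] = 0
firstDiffPos (a ∷ xs) (b ∷ ys) with a ≟ᵇ b
... | no  _ = 1
... | yes _ with firstDiffPos xs ys
...   | zero  = 0
...   | suc k = suc (suc k)

sgn : ∀ {n} → Vec Bool n → Vec Bool n → ℤ
sgn a b = if lexLt b a then -1ℤ else 1ℤ

-- Vertices of K_n, n = 2^(m^2): v = (v^(1),...,v^(m)), blocks in {0,1}^m.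

Block : ℕ → Set
Block m = Vec Bool m

Vertex : ℕ → Set
Vertex m = Vec (Block m) m

firstDiffBlock : ∀ {k m} → Vec (Block m) k → Vec (Block m) k → Maybe (Fin k)
firstDiffBlock [] [] = nothing
firstDiffBlock (a ∷ xs) (b ∷ ys) with vec-≡-dec _≟ᵇ_ a b
... | no  _ = just Fin.zero
... | yes _ with firstDiffBlock xs ys
...   | nothing = nothing
...   | just i  = just (Fin.suc i)

-- Colors: ((i, {x^(i), y^(i)}), i_1..i_m, δ_1..δ_m).
-- The unordered pair {x^(i), y^(i)} (two distinct blocks) is represented
-- canonically as the pair (smaller, larger) in the block order.
Color : ℕ → Set
Color m = (Fin m × (Block m × Block m)) × Vec ℕ m × Vec ℤ m

-- Color of the edge xy, given that x < y and i is the first differing block.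
colorOrdered : ∀ {m} → Vertex m → Vertex m → Fin m → Color m
colorOrdered x y i =
  ( (i , (lookup x i , lookup y i))
  , zipWith firstDiffPos x y
  , zipWith sgn x y )

-- Modified CFLS coloring φ of the edge {x, y}; nothing iff x = y (no edge).
-- The vertex order x < y holds iff x^(i) < y^(i) at the first differing block i.
φ : ∀ {m} → Vertex m → Vertex m → Maybe (Color m)
φ x y with firstDiffBlock x y
... | nothing = nothing
... | just i  = if lexLt (lookup x i) (lookup y i)
                  then just (colorOrdered x y i)
                  else just (colorOrdered y x i)

Edge5 : Set
Edge5 = Fin 5 × Fin 5

IsEdge5 : Edge5 → Set
IsEdge5 (a , b) = a <ᶠ b

ShareVertex : Edge5 → Edge5 → Set
ShareVertex (a , b) (c , d) = (a ≡ c ⊎ a ≡ d) ⊎ (b ≡ c ⊎ b ≡ d)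

record TwoEdgeClass {C : Set} (col : Edge5 → Maybe C) (c : C) : Set where
  field
    e₁ e₂     : Edge5
    edge₁     : IsEdge5 e₁
    edge₂     : IsEdge5 e₂
    distinct  : e₁ ≢ e₂
    col₁      : col e₁ ≡ just c
    col₂      : col e₂ ≡ just c
    onlyThese : ∀ e → IsEdge5 e → col e ≡ just c → e ≡ e₁ ⊎ e ≡ e₂

  IsMatching : Set
  IsMatching = ¬ ShareVertex e₁ e₂

  IsPath : Set
  IsPath = ShareVertex e₁ e₂

record Bad22222 {C : Set} (col : Edge5 → Maybe C) : Set where
  field
    colors   : Fin 5 → C
    distinct : ∀ j k → colors j ≡ colors k → j ≡ k
    covers   : ∀ e → IsEdge5 e → Σ (Fin 5) (λ j → col e ≡ just (colors j))
    classes  : (j : Fin 5) → TwoEdgeClass col (colors j)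
    matching0 : TwoEdgeClass.IsMatching (classes (Fin.zero))
    matching1 : TwoEdgeClass.IsMatching (classes (Fin.suc Fin.zero))
    path2     : TwoEdgeClass.IsPath (classes (Fin.suc (Fin.suc Fin.zero)))
    path3     : TwoEdgeClass.IsPath (classes (Fin.suc (Fin.suc (Fin.suc Fin.zero))))
    path4     : TwoEdgeClass.IsPath (classes (Fin.suc (Fin.suc (Fin.suc (Fin.suc Fin.zero)))))

record CopyK5 (m : ℕ) : Set where
  field
    vtx       : Fin 5 → Vertex m
    injective : ∀ a b → vtx a ≡ vtx b → a ≡ b

  col : Edge5 → Maybe (Color m)
  col (a , b) = φ (vtx a) (vtx b)

{-# OPTIONS --safe #-}
module Submission where

-- Let k be a block in which the five vertices are not all equal, and p the first position of
-- that block at which they are not all equal.  The bit at p cuts the vertices into two nonempty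
-- sides, and as a colour records i_k, an edge crosses the cut iff i_k = p: no colour class mixes
-- crossing and non-crossing edges.  Moreover, if ZX, ZY have one colour and XY, DW another, then
-- at the first block j where X and Y differ, D agrees with X or with Y while Z is equidistant
-- from both, so i_j takes three different values on DX, DY, DZ and these edges get three
-- different colours.  A backtracking search over the labellings of the ten edges by the five
-- classes shows that no 2-2-2-2-2 colouring with two matchings and three paths satisfies both
-- constraints for any cut.

open import Defs
open import Data.Bool using (Bool; true; false; not; _∨_; _xor_; T; T?; if_then_else_)
open import Data.Bool.ListAction using (all)
open import Data.Bool.Properties using (¬-not; not-injective; xor-same) renaming (_≟_ to _≟ᵇ_)
open import Data.Fin using (Fin; zero; suc; toℕ)
open import Data.Fin.Properties using (¬∀⟶∃¬)
  renaming (_≟_ to _≟ᶠ_; _<?_ to _<ᶠ?_; all? to allᶠ?; any? to anyᶠ?)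
open import Data.Fin.Subset using (Subset; outside)
open import Data.Fin.Subset.Properties using (anySubset?)
open import Data.List using (List; []; _∷_; map; allFin; _ʳ++_)
open import Data.List.Membership.Propositional.Properties using (∈-allFin)
open import Data.List.Relation.Unary.All as All using (All; []; _∷_)
open import Data.List.Relation.Unary.All.Properties using (all⁺; map⁺)
open import Data.List.Relation.Unary.Any as Any using (Any; here; there)
open import Data.Maybe using (just; nothing)
open import Data.Maybe.Properties using (just-injective)
open import Data.Nat using (ℕ; zero; suc; _≤_; _≤?_; s≤s; z≤n)
open import Data.Product using (_×_; _,_; proj₁; proj₂; ∃; ∃₂; uncurry)
open import Data.Product.Properties using () renaming (≡-dec to ×-≡-dec)
open import Data.Sum using (_⊎_; inj₁; inj₂)
open import Data.Unit using (⊤)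
open import Data.Vec using (Vec; []; _∷_; head; tail; lookup; tabulate)
open import Data.Vec.Properties using (lookup-zipWith; lookup∘tabulate; tabulate∘lookup; tabulate-cong)
  renaming (≡-dec to vec-≡-dec)
open import Function using (_∘_; case_of_)
open import Function.Bundles using (_⇔_; mk⇔; Equivalence)
open import Function.Properties.Equivalence using () renaming (trans to ⇔-trans; sym to ⇔-sym)
open import Relation.Binary.Definitions using (DecidableEquality)
open import Relation.Binary.PropositionalEquality
open import Relation.Nullary using (¬_; Dec; yes; no; does; ¬?; contradiction)
open import Relation.Nullary.Decidable
  using (_×-dec_; _⊎-dec_; _→-dec_; map′; dec-true; dec-false; from-yes; from-no)
open import Relation.Unary using (Decidable)
open ≡-Reasoning

xor-injective : ∀ r {x y} → r xor x ≡ r xor y → x ≡ y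
xor-injective false eq = eq
xor-injective true  eq = not-injective eq

differing-index : ∀ {A : Set} {k} → DecidableEquality A → {x y : Vec A k} → x ≢ y →
                  ∃ λ i → lookup x i ≢ lookup y i
differing-index _≟_ {x} {y} x≢y =
  ¬∀⟶∃¬ _ _ (λ i → lookup x i ≟ lookup y i) λ pointwise → x≢y (begin
    x                    ≡⟨ tabulate∘lookup x ⟨
    tabulate (lookup x)  ≡⟨ tabulate-cong pointwise ⟩
    tabulate (lookup y)  ≡⟨ tabulate∘lookup y ⟩
    y                    ∎)

end-of-same-pair : {A : Set} {a b d w : A} {p : A × A} → (a , b) ≡ p ⊎ (b , a) ≡ p →
                   (d , w) ≡ p ⊎ (w , d) ≡ p → d ≡ a ⊎ d ≡ b
end-of-same-pair (inj₁ refl) (inj₁ dw≡ab) = inj₁ (cong proj₁ dw≡ab)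
end-of-same-pair (inj₁ refl) (inj₂ wd≡ab) = inj₂ (cong proj₂ wd≡ab)
end-of-same-pair (inj₂ refl) (inj₁ dw≡ba) = inj₂ (cong proj₁ dw≡ba)
end-of-same-pair (inj₂ refl) (inj₂ wd≡ba) = inj₁ (cong proj₂ wd≡ba)

_⇔-dec_ : {A B : Set} → Dec A → Dec B → Dec (A ⇔ B)
a? ⇔-dec b? = map′ (uncurry mk⇔) (λ a⇔b → Equivalence.to a⇔b , Equivalence.from a⇔b)
                   ((a? →-dec b?) ×-dec (b? →-dec a?))

ʳ++⁺ : {A : Set} {P : A → Set} {xs ys : List A} → All P xs → All P ys → All P (xs ʳ++ ys)
ʳ++⁺ []         pys = pys
ʳ++⁺ (px ∷ pxs) pys = ʳ++⁺ pxs (px ∷ pys)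

-- Bit strings

shift : ℕ → ℕ
shift zero    = zero
shift (suc k) = suc (suc k)

shift-injective : ∀ {k l} → shift k ≡ shift l → k ≡ l
shift-injective {zero}  {zero}  _    = refl
shift-injective {suc k} {suc l} refl = refl

shift≢1 : ∀ k → shift k ≢ 1
shift≢1 zero    ()
shift≢1 (suc k) ()

shift≡0 : ∀ {k} → shift k ≡ 0 → k ≡ 0
shift≡0 {zero} _ = refl

module _ {n : ℕ} where

  firstDiffPos-head≡ : ∀ (u v : Vec Bool (suc n)) → head u ≡ head v →
                       firstDiffPos u v ≡ shift (firstDiffPos (tail u) (tail v))
  firstDiffPos-head≡ (a ∷ xs) (.a ∷ ys) refl with a ≟ᵇ a
  ... | no a≢a = contradiction refl a≢a
  ... | yes _ with firstDiffPos xs ys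
  ...   | zero  = refl
  ...   | suc k = refl

  firstDiffPos-head≢ : ∀ (u v : Vec Bool (suc n)) → head u ≢ head v → firstDiffPos u v ≡ 1
  firstDiffPos-head≢ (a ∷ xs) (b ∷ ys) a≢b with a ≟ᵇ b
  ... | yes a≡b = contradiction a≡b a≢b
  ... | no _    = refl

  firstDiffPos≡1⇔head≢ : ∀ (u v : Vec Bool (suc n)) → firstDiffPos u v ≡ 1 ⇔ head u ≢ head v
  firstDiffPos≡1⇔head≢ u v = mk⇔ to (firstDiffPos-head≢ u v)
    where
    to : firstDiffPos u v ≡ 1 → head u ≢ head v
    to pos≡1 heads≡ = shift≢1 _ (trans (sym (firstDiffPos-head≡ u v heads≡)) pos≡1)

firstDiffPos-sym : ∀ {n} (u v : Vec Bool n) → firstDiffPos u v ≡ firstDiffPos v u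
firstDiffPos-sym [] [] = refl
firstDiffPos-sym u@(a ∷ xs) v@(b ∷ ys) = by-heads (a ≟ᵇ b)
  where
  by-heads : Dec (a ≡ b) → firstDiffPos u v ≡ firstDiffPos v u
  by-heads (yes a≡b) = begin
    firstDiffPos u v            ≡⟨ firstDiffPos-head≡ u v a≡b ⟩
    shift (firstDiffPos xs ys)  ≡⟨ cong shift (firstDiffPos-sym xs ys) ⟩
    shift (firstDiffPos ys xs)  ≡⟨ firstDiffPos-head≡ v u (sym a≡b) ⟨
    firstDiffPos v u            ∎
  by-heads (no a≢b) = trans (firstDiffPos-head≢ u v a≢b) (sym (firstDiffPos-head≢ v u (a≢b ∘ sym)))

firstDiffPos-self : ∀ {n} (u : Vec Bool n) → firstDiffPos u u ≡ 0
firstDiffPos-self [] = refl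
firstDiffPos-self u@(a ∷ xs) = trans (firstDiffPos-head≡ u u refl) (cong shift (firstDiffPos-self xs))

firstDiffPos≡0⇒≡ : ∀ {n} (u v : Vec Bool n) → firstDiffPos u v ≡ 0 → u ≡ v
firstDiffPos≡0⇒≡ [] [] _ = refl
firstDiffPos≡0⇒≡ u@(a ∷ xs) v@(b ∷ ys) pos≡0 = by-heads (a ≟ᵇ b)
  where
  by-heads : Dec (a ≡ b) → u ≡ v
  by-heads (yes a≡b) = cong₂ _∷_ a≡b
    (firstDiffPos≡0⇒≡ xs ys (shift≡0 (trans (sym (firstDiffPos-head≡ u v a≡b)) pos≡0)))
  by-heads (no a≢b) with () ← trans (sym (firstDiffPos-head≢ u v a≢b)) pos≡0

-- At the first position where three strings pairwise differ they would need three different bits.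
firstDiffPos-ultrametric : ∀ {n} (u v w : Vec Bool n) → firstDiffPos u v ≡ firstDiffPos u w →
                           firstDiffPos u v ≡ firstDiffPos v w → u ≡ v
firstDiffPos-ultrametric [] [] [] _ _ = refl
firstDiffPos-ultrametric u@(a ∷ xs) v@(b ∷ ys) w@(c ∷ zs) uv≡uw uv≡vw = by-heads (a ≟ᵇ b) (a ≟ᵇ c)
  where
  by-heads : Dec (a ≡ b) → Dec (a ≡ c) → u ≡ v
  by-heads (yes a≡b) (yes a≡c) =
    cong₂ _∷_ a≡b (firstDiffPos-ultrametric xs ys zs (shift-injective xy≡xz) (shift-injective xy≡yz))
    where
    xy≡xz : shift (firstDiffPos xs ys) ≡ shift (firstDiffPos xs zs)
    xy≡xz = trans (sym (firstDiffPos-head≡ u v a≡b)) (trans uv≡uw (firstDiffPos-head≡ u w a≡c))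
    xy≡yz : shift (firstDiffPos xs ys) ≡ shift (firstDiffPos ys zs)
    xy≡yz = trans (sym (firstDiffPos-head≡ u v a≡b))
                  (trans uv≡vw (firstDiffPos-head≡ v w (trans (sym a≡b) a≡c)))
  by-heads (yes a≡b) (no a≢c) = contradiction
    (trans (sym (firstDiffPos-head≡ u v a≡b)) (trans uv≡uw (firstDiffPos-head≢ u w a≢c))) (shift≢1 _)
  by-heads (no a≢b) _ = contradiction (trans (¬-not (a≢b ∘ sym)) (sym (¬-not (a≢c ∘ sym)))) b≢c
    where
    uv≡1 : firstDiffPos u v ≡ 1
    uv≡1 = firstDiffPos-head≢ u v a≢b
    a≢c : a ≢ c
    a≢c = Equivalence.to (firstDiffPos≡1⇔head≢ u w) (trans (sym uv≡uw) uv≡1)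
    b≢c : b ≢ c
    b≢c = Equivalence.to (firstDiffPos≡1⇔head≢ v w) (trans (sym uv≡vw) uv≡1)

Distinct₃ : {A : Set} → A → A → A → Set
Distinct₃ x y z = x ≢ y × x ≢ z × y ≢ z

distinct-positions-from-end : ∀ {n} {a b z : Vec Bool n} →
                              a ≢ b → firstDiffPos z a ≡ firstDiffPos z b →
                              Distinct₃ (firstDiffPos a a) (firstDiffPos a b) (firstDiffPos a z)
distinct-positions-from-end {a = a} {b} {z} a≢b za≡zb = aa≢ab , aa≢az , ab≢az
  where
  aa≢ab : firstDiffPos a a ≢ firstDiffPos a b
  aa≢ab aa≡ab = a≢b (firstDiffPos≡0⇒≡ a b (trans (sym aa≡ab) (firstDiffPos-self a)))
  aa≢az : firstDiffPos a a ≢ firstDiffPos a z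
  aa≢az aa≡az with refl ← firstDiffPos≡0⇒≡ a z (trans (sym aa≡az) (firstDiffPos-self a)) =
    a≢b (firstDiffPos≡0⇒≡ a b (trans (sym za≡zb) (firstDiffPos-self a)))
  ab≢az : firstDiffPos a b ≢ firstDiffPos a z
  ab≢az ab≡az = a≢b (firstDiffPos-ultrametric a b z ab≡az (begin
    firstDiffPos a b  ≡⟨ ab≡az ⟩
    firstDiffPos a z  ≡⟨ firstDiffPos-sym a z ⟩
    firstDiffPos z a  ≡⟨ za≡zb ⟩
    firstDiffPos z b  ≡⟨ firstDiffPos-sym z b ⟩
    firstDiffPos b z  ∎))

distinct-positions-from-ends : ∀ {n} {a b z d : Vec Bool n} →
                               a ≢ b → firstDiffPos z a ≡ firstDiffPos z b → d ≡ a ⊎ d ≡ b →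
                               Distinct₃ (firstDiffPos d a) (firstDiffPos d b) (firstDiffPos d z)
distinct-positions-from-ends a≢b za≡zb (inj₁ refl) = distinct-positions-from-end a≢b za≡zb
distinct-positions-from-ends a≢b za≡zb (inj₂ refl) =
  let bb≢ba , bb≢bz , ba≢bz = distinct-positions-from-end (a≢b ∘ sym) (sym za≡zb)
  in  bb≢ba ∘ sym , ba≢bz , bb≢bz

head-tail-injective : ∀ {A : Set} {n} (u v : Vec A (suc n)) → head u ≡ head v → tail u ≡ tail v → u ≡ v
head-tail-injective (a ∷ xs) (b ∷ ys) = cong₂ _∷_

record Split {k n} (u : Fin k → Vec Bool n) : Set where
  field
    position    : ℕ
    side        : Fin k → Bool
    nonconstant : ∃₂ λ x y → side x ≢ side y
    splits      : ∀ x y → firstDiffPos (u x) (u y) ≡ position ⇔ side x ≢ side y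

split : ∀ {k n} (u : Fin k → Vec Bool n) {a b} → u a ≢ u b → Split u
split {n = zero} u {a} {b} ua≢ub = contradiction (empty (u a) (u b)) ua≢ub
  where
  empty : (x y : Vec Bool 0) → x ≡ y
  empty [] [] = refl
split {n = suc n} u {a} {b} ua≢ub with allᶠ? (λ x → head (u x) ≟ᵇ head (u a))
... | no heads-differ = record
  { position    = 1
  ; side        = head ∘ u
  ; nonconstant = let x , hx≢ha = ¬∀⟶∃¬ _ _ (λ x → head (u x) ≟ᵇ head (u a)) heads-differ
                  in  x , a , hx≢ha
  ; splits      = λ x y → firstDiffPos≡1⇔head≢ (u x) (u y)
  }
... | yes heads-agree = record
  { position    = shift position
  ; side        = side
  ; nonconstant = nonconstant
  ; splits      = λ x y → ⇔-trans (shift-cancel x y) (splits x y)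
  }
  where
  tails-differ : tail (u a) ≢ tail (u b)
  tails-differ = ua≢ub ∘ head-tail-injective (u a) (u b) (sym (heads-agree b))
  open Split (split (tail ∘ u) tails-differ)
  shift-cancel : ∀ x y → firstDiffPos (u x) (u y) ≡ shift position ⇔
                         firstDiffPos (tail (u x)) (tail (u y)) ≡ position
  shift-cancel x y rewrite firstDiffPos-head≡ (u x) (u y) (trans (heads-agree x) (sym (heads-agree y))) =
    mk⇔ shift-injective (cong shift)

-- Vertices and colours

firstDiffBlock-sym : ∀ {k m} (xs ys : Vec (Block m) k) → firstDiffBlock xs ys ≡ firstDiffBlock ys xs
firstDiffBlock-sym [] [] = refl
firstDiffBlock-sym (a ∷ xs) (b ∷ ys) with vec-≡-dec _≟ᵇ_ a b | vec-≡-dec _≟ᵇ_ b a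
... | no _     | no _     = refl
... | yes a≡b  | no b≢a   = contradiction (sym a≡b) b≢a
... | no a≢b   | yes b≡a  = contradiction (sym b≡a) a≢b
... | yes refl | yes refl rewrite firstDiffBlock-sym xs ys = refl

firstDiffBlock-differs : ∀ {k m} (xs ys : Vec (Block m) k) {i} → firstDiffBlock xs ys ≡ just i →
                         lookup xs i ≢ lookup ys i
firstDiffBlock-differs (a ∷ xs) (b ∷ ys) eq with vec-≡-dec _≟ᵇ_ a b
firstDiffBlock-differs (a ∷ xs) (b ∷ ys) refl | no a≢b = a≢b
... | yes refl with firstDiffBlock xs ys in eq′
firstDiffBlock-differs (a ∷ xs) (a ∷ ys) refl | yes refl | just i = firstDiffBlock-differs xs ys eq′

lexLt-flip : ∀ {n} {a b : Vec Bool n} → a ≢ b → lexLt b a ≡ not (lexLt a b)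
lexLt-flip {a = []}          {[]}          a≢b = contradiction refl a≢b
lexLt-flip {a = false ∷ xs}  {false ∷ ys}  a≢b = lexLt-flip (a≢b ∘ cong (false ∷_))
lexLt-flip {a = true ∷ xs}   {true ∷ ys}   a≢b = lexLt-flip (a≢b ∘ cong (true ∷_))
lexLt-flip {a = false ∷ xs}  {true ∷ ys}   _   = refl
lexLt-flip {a = true ∷ xs}   {false ∷ ys}  _   = refl

φ-sym : ∀ {m} (x y : Vertex m) → φ x y ≡ φ y x
φ-sym x y rewrite firstDiffBlock-sym x y with firstDiffBlock y x in eq
... | nothing = refl
... | just i rewrite lexLt-flip (firstDiffBlock-differs y x eq) with lexLt (lookup y i) (lookup x i)
...   | true  = refl
...   | false = refl

module _ {m : ℕ} where

  block : Color m → Fin m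
  block = proj₁ ∘ proj₁

  blockPair : Color m → Block m × Block m
  blockPair = proj₂ ∘ proj₁

  positions : Color m → Vec ℕ m
  positions = proj₁ ∘ proj₂

  φ-just : ∀ (x y : Vertex m) {c} → φ x y ≡ just c →
           ∃ λ i → firstDiffBlock x y ≡ just i × (c ≡ colorOrdered x y i ⊎ c ≡ colorOrdered y x i)
  φ-just x y eq with firstDiffBlock x y
  φ-just x y () | nothing
  ... | just i with lexLt (lookup x i) (lookup y i)
  ...   | true  = i , refl , inj₁ (sym (just-injective eq))
  ...   | false = i , refl , inj₂ (sym (just-injective eq))

  φ-block : ∀ (x y : Vertex m) {c} → φ x y ≡ just c → firstDiffBlock x y ≡ just (block c)
  φ-block x y eq with φ-just x y eq
  ... | i , first , inj₁ refl = first
  ... | i , first , inj₂ refl = first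

  φ-blockPair : ∀ (x y : Vertex m) {c} → φ x y ≡ just c →
                (lookup x (block c) , lookup y (block c)) ≡ blockPair c ⊎
                (lookup y (block c) , lookup x (block c)) ≡ blockPair c
  φ-blockPair x y eq with φ-just x y eq
  ... | i , _ , inj₁ refl = inj₁ refl
  ... | i , _ , inj₂ refl = inj₂ refl

  φ-positions : ∀ (x y : Vertex m) {c} → φ x y ≡ just c →
                ∀ k → lookup (positions c) k ≡ firstDiffPos (lookup x k) (lookup y k)
  φ-positions x y eq k with φ-just x y eq
  ... | i , _ , inj₁ refl = lookup-zipWith firstDiffPos k x y
  ... | i , _ , inj₂ refl =
    trans (lookup-zipWith firstDiffPos k y x) (firstDiffPos-sym (lookup y k) (lookup x k))

  SameColour : Vertex m → Vertex m → Vertex m → Vertex m → Set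
  SameColour x y z w = ∃ λ c → φ x y ≡ just c × φ z w ≡ just c

  same-positions : ∀ x y z w → SameColour x y z w →
                   ∀ k → firstDiffPos (lookup x k) (lookup y k) ≡ firstDiffPos (lookup z k) (lookup w k)
  same-positions x y z w (c , xy , zw) k = trans (sym (φ-positions x y xy k)) (φ-positions z w zw k)

cherry-lemma : ∀ {m} (X Y Z D W : Vertex m) → SameColour Z X Z Y → SameColour X Y D W →
               ¬ SameColour D X D Y × ¬ SameColour D X D Z × ¬ SameColour D Y D Z
cherry-lemma {m} X Y Z D W (c , zx , zy) (d , xy , dw) =
  let dx≢dy , dx≢dz , dy≢dz = distinct
  in  (λ s → dx≢dy (same-positions D X D Y s j)) ,
      (λ s → dx≢dz (same-positions D X D Z s j)) ,
      (λ s → dy≢dz (same-positions D Y D Z s j))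
  where
  j : Fin m
  j = block d
  equidistant : firstDiffPos (lookup Z j) (lookup X j) ≡ firstDiffPos (lookup Z j) (lookup Y j)
  equidistant = trans (sym (φ-positions Z X zx j)) (φ-positions Z Y zy j)
  distinct : Distinct₃ (firstDiffPos (lookup D j) (lookup X j)) (firstDiffPos (lookup D j) (lookup Y j))
                       (firstDiffPos (lookup D j) (lookup Z j))
  distinct = distinct-positions-from-ends (firstDiffBlock-differs X Y (φ-block X Y xy)) equidistant
               (end-of-same-pair (φ-blockPair X Y xy) (φ-blockPair D W dw))

-- Labellings of the edges of K_5 by colour classes

module Backtracking {E : Set} {n : ℕ} {Viable Admissible : List (E × Fin n) → Set}
                    (viable? : Decidable Viable) (admissible? : Decidable Admissible) where

  -- Every labelling of es extending acc fails Viable after some step or Admissible at the end.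
  refutes : List E → List (E × Fin n) → Bool
  refutes []       acc = not (does (admissible? acc))
  refutes (e ∷ es) acc =
    all (λ i → not (does (viable? ((e , i) ∷ acc))) ∨ refutes es ((e , i) ∷ acc)) (allFin n)

  module _ {Good : E × Fin n → Set} (viable : ∀ {x xs} → Good x → All Good xs → Viable (x ∷ xs))
           (κ : E → Fin n) where

    refutes-sound : ∀ es {acc} → All Good acc → All (λ e → Good (e , κ e)) es →
                    Admissible (map (λ e → e , κ e) es ʳ++ acc) → ¬ T (refutes es acc)
    refutes-sound [] {acc} _ _ admissible refuted =
      subst (T ∘ not) (dec-true (admissible? acc) admissible) refuted
    refutes-sound (e ∷ es) {acc} good-acc (good-e ∷ good-es) admissible refuted =
      refutes-sound es (good-e ∷ good-acc) good-es admissible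
        (subst (λ b → T (not b ∨ refutes es ((e , κ e) ∷ acc))) viable-e chosen)
      where
      chosen : T (not (does (viable? ((e , κ e) ∷ acc))) ∨ refutes es ((e , κ e) ∷ acc))
      chosen = All.lookup (all⁺ _ (allFin n) refuted) (∈-allFin (κ e))
      viable-e : does (viable? ((e , κ e) ∷ acc)) ≡ true
      viable-e = dec-true (viable? _) (viable good-e good-acc)

ShareVertex-sym : ∀ {e f} → ShareVertex e f → ShareVertex f e
ShareVertex-sym (inj₁ (inj₁ a≡c)) = inj₁ (inj₁ (sym a≡c))
ShareVertex-sym (inj₁ (inj₂ a≡d)) = inj₂ (inj₁ (sym a≡d))
ShareVertex-sym (inj₂ (inj₁ b≡c)) = inj₁ (inj₂ (sym b≡c))
ShareVertex-sym (inj₂ (inj₂ b≡d)) = inj₂ (inj₂ (sym b≡d))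

shareVertex? : ∀ e f → Dec (ShareVertex e f)
shareVertex? (a , b) (c , d) = ((a ≟ᶠ c) ⊎-dec (a ≟ᶠ d)) ⊎-dec ((b ≟ᶠ c) ⊎-dec (b ≟ᶠ d))

_≟ᵉ_ : DecidableEquality Edge5
_≟ᵉ_ = ×-≡-dec _≟ᶠ_ _≟ᶠ_

Entry : Set
Entry = Edge5 × Fin 5

-- In Bad22222 the classes 0 and 1 are the matchings and the classes 2, 3, 4 the paths.
IsPathClass : Fin 5 → Set
IsPathClass i = 2 ≤ toℕ i

Crosses : Subset 5 → Edge5 → Set
Crosses S (a , b) = lookup S a ≢ lookup S b

crosses? : ∀ S e → Dec (Crosses S e)
crosses? S (a , b) = ¬? (lookup S a ≟ᵇ lookup S b)

Nonconstant : Subset 5 → Set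
Nonconstant S = ∃₂ λ a b → Crosses S (a , b)

nonconstant? : ∀ S → Dec (Nonconstant S)
nonconstant? S = anyᶠ? λ a → anyᶠ? λ b → crosses? S (a , b)

-- The last component: f is the only earlier edge in the class of the new entry (e , i).
Compatible : Subset 5 → List Entry → Entry → Entry → Set
Compatible S acc (e , i) (f , j) = i ≡ j → e ≢ f →
  (ShareVertex e f ⇔ IsPathClass i) × (Crosses S e ⇔ Crosses S f) ×
  All (λ (g , k) → i ≡ k → e ≢ g → f ≡ g) acc

compatible? : ∀ S acc x y → Dec (Compatible S acc x y)
compatible? S acc (e , i) (f , j) = (i ≟ᶠ j) →-dec ¬? (e ≟ᵉ f) →-dec
  (shareVertex? e f ⇔-dec (2 ≤? toℕ i)) ×-dec (crosses? S e ⇔-dec crosses? S f) ×-dec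
  All.all? (λ (g , k) → (i ≟ᶠ k) →-dec ¬? (e ≟ᵉ g) →-dec (f ≟ᵉ g)) acc

Viable : Subset 5 → List Entry → Set
Viable S []        = ⊤
Viable S (x ∷ acc) = All (Compatible S acc x) acc

viable? : ∀ S → Decidable (Viable S)
viable? S []        = yes _
viable? S (x ∷ acc) = All.all? (compatible? S acc x) acc

Joins : Edge5 → Fin 5 → Fin 5 → Set
Joins (c , d) a b = (c ≡ a × d ≡ b) ⊎ (c ≡ b × d ≡ a)

joins? : ∀ e a b → Dec (Joins e a b)
joins? (c , d) a b = ((c ≟ᶠ a) ×-dec (d ≟ᶠ b)) ⊎-dec ((c ≟ᶠ b) ×-dec (d ≟ᶠ a))

-- Pairs that no entry joins get the junk class 0.
classOf : List Entry → Fin 5 → Fin 5 → Fin 5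
classOf []              a b = zero
classOf ((e , i) ∷ acc) a b = if does (joins? e a b) then i else classOf acc a b

Listed : List Entry → Fin 5 → Fin 5 → Set
Listed acc a b = Any (λ (e , _) → Joins e a b) acc

-- The conclusion of cherry-lemma, for class labels.
Admissible : List Entry → Set
Admissible acc = ∀ Z X Y → Z ≢ X → Z ≢ Y → X ≢ Y → κ Z X ≡ κ Z Y →
                 ∀ D W → D ≢ W → D ≢ X → D ≢ Y → D ≢ Z → κ X Y ≡ κ D W →
                 κ D X ≢ κ D Y × κ D X ≢ κ D Z × κ D Y ≢ κ D Z
  where
  κ : Fin 5 → Fin 5 → Fin 5
  κ = classOf acc

admissible? : Decidable Admissible
admissible? acc =
  allᶠ? λ Z → allᶠ? λ X → allᶠ? λ Y →
    ¬? (Z ≟ᶠ X) →-dec ¬? (Z ≟ᶠ Y) →-dec ¬? (X ≟ᶠ Y) →-dec (κ Z X ≟ᶠ κ Z Y) →-dec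
  allᶠ? λ D → allᶠ? λ W →
    ¬? (D ≟ᶠ W) →-dec ¬? (D ≟ᶠ X) →-dec ¬? (D ≟ᶠ Y) →-dec ¬? (D ≟ᶠ Z) →-dec (κ X Y ≟ᶠ κ D W) →-dec
    ¬? (κ D X ≟ᶠ κ D Y) ×-dec ¬? (κ D X ≟ᶠ κ D Z) ×-dec ¬? (κ D Y ≟ᶠ κ D Z)
  where
  κ : Fin 5 → Fin 5 → Fin 5
  κ = classOf acc

edges : List Edge5
edges = (v₀ , v₁) ∷ (v₀ , v₂) ∷ (v₀ , v₃) ∷ (v₀ , v₄) ∷ (v₁ , v₂) ∷
        (v₁ , v₃) ∷ (v₁ , v₄) ∷ (v₂ , v₃) ∷ (v₂ , v₄) ∷ (v₃ , v₄) ∷ []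
  where
  v₀ v₁ v₂ v₃ v₄ : Fin 5
  v₀ = zero
  v₁ = suc zero
  v₂ = suc (suc zero)
  v₃ = suc (suc (suc zero))
  v₄ = suc (suc (suc (suc zero)))

open Backtracking using (refutes; refutes-sound)

-- Proved by running the search on the 15 nonconstant cuts with vertex 0 outside.
cuts-refuted : ¬ ∃ λ S → Nonconstant (outside ∷ S) ×
                         ¬ T (refutes (viable? (outside ∷ S)) admissible? edges [])
cuts-refuted = from-no (anySubset? λ S →
  nonconstant? (outside ∷ S) ×-dec ¬? (T? (refutes (viable? (outside ∷ S)) admissible? edges [])))

-- The colouring of a bad copy of K_5

module _ {m : ℕ} (K : CopyK5 m) (B : Bad22222 (CopyK5.col K)) where
  open CopyK5 K
  open Bad22222 B
  open TwoEdgeClass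

  InClass : Entry → Set
  InClass (e , i) = IsEdge5 e × col e ≡ just (colors i)

  class-member : ∀ {e i} → InClass (e , i) → e ≡ e₁ (classes i) ⊎ e ≡ e₂ (classes i)
  class-member {e} {i} (edge , colour) = onlyThese (classes i) e edge colour

  classmates : ∀ {e f i} → InClass (e , i) → InClass (f , i) → e ≢ f →
               (e ≡ e₁ (classes i) × f ≡ e₂ (classes i)) ⊎ (e ≡ e₂ (classes i) × f ≡ e₁ (classes i))
  classmates e∈i f∈i e≢f with class-member e∈i | class-member f∈i
  ... | inj₁ e≡e₁ | inj₁ f≡e₁ = contradiction (trans e≡e₁ (sym f≡e₁)) e≢f
  ... | inj₁ e≡e₁ | inj₂ f≡e₂ = inj₁ (e≡e₁ , f≡e₂)
  ... | inj₂ e≡e₂ | inj₁ f≡e₁ = inj₂ (e≡e₂ , f≡e₁)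
  ... | inj₂ e≡e₂ | inj₂ f≡e₂ = contradiction (trans e≡e₂ (sym f≡e₂)) e≢f

  class-shape : ∀ i → ShareVertex (e₁ (classes i)) (e₂ (classes i)) ⇔ IsPathClass i
  class-shape zero                         = mk⇔ (λ share → contradiction share matching0) λ ()
  class-shape (suc zero)                   = mk⇔ (λ share → contradiction share matching1) λ { (s≤s ()) }
  class-shape (suc (suc zero))             = mk⇔ (λ _ → s≤s (s≤s z≤n)) (λ _ → path2)
  class-shape (suc (suc (suc zero)))       = mk⇔ (λ _ → s≤s (s≤s z≤n)) (λ _ → path3)
  class-shape (suc (suc (suc (suc zero)))) = mk⇔ (λ _ → s≤s (s≤s z≤n)) (λ _ → path4)

  shape : ∀ {e f i} → InClass (e , i) → InClass (f , i) → e ≢ f → ShareVertex e f ⇔ IsPathClass i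
  shape {i = i} e∈i f∈i e≢f with classmates e∈i f∈i e≢f
  ... | inj₁ (refl , refl) = class-shape i
  ... | inj₂ (refl , refl) = ⇔-trans (mk⇔ ShareVertex-sym ShareVertex-sym) (class-shape i)

  unique-mate : ∀ {e f g i} → InClass (e , i) → InClass (f , i) → InClass (g , i) →
                e ≢ f → e ≢ g → f ≡ g
  unique-mate {i = i} e∈i f∈i g∈i e≢f e≢g with classmates e∈i f∈i e≢f | classmates e∈i g∈i e≢g
  ... | inj₁ (_ , f≡e₂) | inj₁ (_ , g≡e₂) = trans f≡e₂ (sym g≡e₂)
  ... | inj₂ (_ , f≡e₁) | inj₂ (_ , g≡e₁) = trans f≡e₁ (sym g≡e₁)
  ... | inj₁ (e≡e₁ , _) | inj₂ (e≡e₂ , _) = contradiction (trans (sym e≡e₁) e≡e₂) (distinct (classes i))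
  ... | inj₂ (e≡e₂ , _) | inj₁ (e≡e₁ , _) = contradiction (trans (sym e≡e₁) e≡e₂) (distinct (classes i))

  splitting-block : ∃ λ k → lookup (vtx zero) k ≢ lookup (vtx (suc zero)) k
  splitting-block =
    differing-index (vec-≡-dec _≟ᵇ_) λ v₀≡v₁ → case injective zero (suc zero) v₀≡v₁ of λ ()

  slice : Fin 5 → Block m
  slice a = lookup (vtx a) (proj₁ splitting-block)

  open Split (split slice (proj₂ splitting-block))

  -- Complementing the cut changes no crossing, so vertex 0 may be put outside.
  cut₄ : Subset 4
  cut₄ = tabulate (λ a → side zero xor side (suc a))

  cut : Subset 5
  cut = outside ∷ cut₄

  lookup-cut : ∀ a → lookup cut a ≡ side zero xor side a
  lookup-cut zero    = sym (xor-same (side zero))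
  lookup-cut (suc a) = lookup∘tabulate (λ a → side zero xor side (suc a)) a

  crosses⇔ : ∀ a b → Crosses cut (a , b) ⇔ firstDiffPos (slice a) (slice b) ≡ position
  crosses⇔ a b rewrite lookup-cut a | lookup-cut b = ⇔-trans
    (mk⇔ (λ sides≢ → sides≢ ∘ cong (side zero xor_)) (λ sides≢ → sides≢ ∘ xor-injective (side zero)))
    (⇔-sym (splits a b))

  cut-nonconstant : Nonconstant cut
  cut-nonconstant = let x , y , x≢y = nonconstant
                    in  x , y , Equivalence.from (crosses⇔ x y) (Equivalence.from (splits x y) x≢y)

  crossing : ∀ {e f i} → InClass (e , i) → InClass (f , i) → Crosses cut e ⇔ Crosses cut f
  crossing {a , b} {c , d} (_ , ab) (_ , cd) =
    ⇔-trans (crosses⇔ a b) (⇔-trans (mk⇔ (trans (sym same)) (trans same)) (⇔-sym (crosses⇔ c d)))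
    where
    same : firstDiffPos (slice a) (slice b) ≡ firstDiffPos (slice c) (slice d)
    same = same-positions (vtx a) (vtx b) (vtx c) (vtx d) (_ , ab , cd) (proj₁ splitting-block)

  viable : ∀ {x acc} → InClass x → All InClass acc → Viable cut (x ∷ acc)
  viable {e , i} {acc} e∈i acc-in-classes = All.map compatible acc-in-classes
    where
    compatible : ∀ {y} → InClass y → Compatible cut acc (e , i) y
    compatible f∈i refl e≢f =
      shape e∈i f∈i e≢f , crossing e∈i f∈i ,
      All.map (λ g∈k → λ { refl e≢g → unique-mate e∈i f∈i g∈k e≢f e≢g }) acc-in-classes

  class : Edge5 → Fin 5
  class (a , b) with a <ᶠ? b
  ... | yes a<b = proj₁ (covers (a , b) a<b)
  ... | no  _   = zero

  in-class : ∀ e → IsEdge5 e → InClass (e , class e)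
  in-class (a , b) a<b with a <ᶠ? b
  ... | yes a<b′ = a<b , proj₂ (covers (a , b) a<b′)
  ... | no  a≮b  = contradiction a<b a≮b

  edges-in-classes : All (λ e → InClass (e , class e)) edges
  edges-in-classes = All.map (in-class _) (from-yes (All.all? (λ (a , b) → a <ᶠ? b) edges))

  labelling : List Entry
  labelling = map (λ e → e , class e) edges ʳ++ []

  joined-colour : ∀ {e i a b} → InClass (e , i) → Joins e a b → φ (vtx a) (vtx b) ≡ just (colors i)
  joined-colour         (_ , colour) (inj₁ (refl , refl)) = colour
  joined-colour {c , d} (_ , colour) (inj₂ (refl , refl)) = trans (φ-sym (vtx d) (vtx c)) colour

  classOf-colour : ∀ {acc a b} → All InClass acc → Listed acc a b →
                   φ (vtx a) (vtx b) ≡ just (colors (classOf acc a b))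
  classOf-colour {(e , i) ∷ acc} {a} {b} (e∈i ∷ acc-in-classes) = by-cases (joins? e a b)
    where
    head-class : ∀ {t} → does (joins? e a b) ≡ t →
                 classOf ((e , i) ∷ acc) a b ≡ (if t then i else classOf acc a b)
    head-class = cong (λ t → if t then i else classOf acc a b)
    by-cases : Dec (Joins e a b) → Listed ((e , i) ∷ acc) a b →
               φ (vtx a) (vtx b) ≡ just (colors (classOf ((e , i) ∷ acc) a b))
    by-cases (yes joins) _ = trans (joined-colour e∈i joins)
      (cong (just ∘ colors) (sym (head-class (dec-true (joins? e a b) joins))))
    by-cases (no ¬joins) (here joins) = contradiction joins ¬joins
    by-cases (no ¬joins) (there listed) = trans (classOf-colour acc-in-classes listed)
      (cong (just ∘ colors) (sym (head-class (dec-false (joins? e a b) ¬joins))))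

  labelling-listed : ∀ a b → a ≢ b → Listed labelling a b
  labelling-listed = from-yes (allᶠ? λ a → allᶠ? λ b →
    ¬? (a ≟ᶠ b) →-dec Any.any? (λ (e , _) → joins? e a b) labelling)

  labelling-admissible : Admissible labelling
  labelling-admissible Z X Y Z≢X Z≢Y X≢Y zx~zy D W D≢W D≢X D≢Y D≢Z xy~dw =
    let dx≁dy , dx≁dz , dy≁dz = cherry-lemma (vtx X) (vtx Y) (vtx Z) (vtx D) (vtx W)
                                  (same Z≢X Z≢Y zx~zy) (same X≢Y D≢W xy~dw)
    in  dx≁dy ∘ same D≢X D≢Y , dx≁dz ∘ same D≢X D≢Z , dy≁dz ∘ same D≢Y D≢Z
    where
    colour-of : ∀ {a b} → a ≢ b → φ (vtx a) (vtx b) ≡ just (colors (classOf labelling a b))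
    colour-of {a} {b} a≢b = classOf-colour (ʳ++⁺ (map⁺ edges-in-classes) []) (labelling-listed a b a≢b)
    same : ∀ {a b c d} → a ≢ b → c ≢ d → classOf labelling a b ≡ classOf labelling c d →
           SameColour (vtx a) (vtx b) (vtx c) (vtx d)
    same a≢b c≢d ab~cd = _ , colour-of a≢b , trans (colour-of c≢d) (cong (just ∘ colors) (sym ab~cd))

-- The implicit predicates of
-- refutes-sound are named so that its type is syntactically that of cuts-refuted; otherwise
-- Agda would compare the two by running the search symbolically.
lemma15 : (m : ℕ) → 1 ≤ m → (K : CopyK5 m) → ¬ Bad22222 (CopyK5.col K)
lemma15 m _ K B = cuts-refuted (cut₄ K B , cut-nonconstant K B ,
  refutes-sound {Viable = Viable (outside ∷ cut₄ K B)} {Admissible = Admissible}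
    (viable? (outside ∷ cut₄ K B)) admissible? (viable K B) (class K B) edges []
    (edges-in-classes K B) (labelling-admissible K B))
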